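{- Let $N'\mid N$ be positive integers and $D=D_{N,N'}=(\mathbb{Z}/N\mathbb{Z})^2\oplus(\mathbb{Z}/N'\mathbb{Z})^2$ with $Q(x,y,z,w)=\frac{xy}{N}+\frac{zw}{N'}\bmod\mathbb{Z}$. Let $H$ be a self-dual isotropic subgroup of $D$ whose projections to the two summands are $\pi_1(H)=H_{x,y,z}\subseteq(\mathbb{Z}/N\mathbb{Z})^2$ and $\pi_2(H)=H_{x',y',z'}\subseteq(\mathbb{Z}/N'\mathbb{Z})^2$ (normalized triples). Then there exist $(a,b),(c,d)\in H_{x',y',z'}$ such that $$H=\big\langle (x,y,a,b),\ (0,z,c,d),\ (0,0,N'/z',-N'y'/(x'z')),\ (0,0,0,N'/x')\big\rangle,$$ and $(a,b)$ and $(c,d)$ are uniquely determined modulo $H_{x',y',z'}^\perp$ (the orthogonal complement in $(\mathbb{Z}/N'\mathbb{Z})^2$).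
   Context: For $M\ge1$, on $(\mathbb{Z}/M\mathbb{Z})^2$ with $Q(x,y)=xy/M$ and bilinear form $((x,y),(x',y'))=(xy'+x'y)/M$, $H_{x,y,z}$ denotes the subgroup generated by $(x,y)$ and $(0,z)$, always normalized so that $x,z$ are divisors of $M$, $x$ is the least positive integer with $(x,r)$ in the subgroup for some $r$, $z$ the least positive integer with $(0,z)$ in it, and $0\le y<z$. The last two generators displayed generate $\{0\}\oplus H^\perp_{x',y',z'}$. For a subgroup $H$, $H^\perp=\{\gamma:(\gamma,H)=0\}$; self-dual means $H=H^\perp$; isotropic means $H\subseteq H^\perp$ and $Q|_H=0$. -}

module Defs where

open import Data.Nat as ℕ using (ℕ; zero; suc; _≤_; _<_)
import Data.Nat.DivMod as ℕD
import Data.Nat.Divisibility as ℕDiv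
open import Data.Integer using (ℤ; +_; _+_; _*_; -_; _-_)
open import Data.Integer.Divisibility using (_∣_)
open import Data.Product using (_×_; _,_; Σ; ∃; ∃-syntax)

_⟺_ : Set → Set → Set
A ⟺ B = (A → B) × (B → A)

_≡_[mod_] : ℤ → ℤ → ℕ → Set
a ≡ b [mod M ] = (+ M) ∣ (a - b)

-- natural-number division, used only with positive divisors
divℕ : ℕ → ℕ → ℕ
divℕ m zero = 0
divℕ m (suc n) = ℕD._/_ m (suc n)

-- (ℤ/Mℤ)²,  represented by ℤ × ℤ; subgroups are predicates on ℤ²
-- containing the kernel (Mℤ)² (correspondence theorem).

Elt2 : Set
Elt2 = ℤ × ℤ

Hxyz : ℕ → ℕ → ℕ → ℕ → Elt2 → Set
Hxyz M x y z (u , v) =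
  ∃[ k ] ∃[ l ] ((u ≡ k * + x [mod M ]) × (v ≡ k * + y + l * + z [mod M ]))

record Normalized (M x y z : ℕ) : Set where
  field
    x∣M   : x ℕDiv.∣ M
    z∣M   : z ℕDiv.∣ M
    y<z   : y < z
    x-pos : 1 ≤ x
    z-pos : 1 ≤ z
    x-least : ∀ (t : ℕ) (r : ℤ) → 1 ≤ t → Hxyz M x y z (+ t , r) → x ≤ t
    z-least : ∀ (t : ℕ) → 1 ≤ t → Hxyz M x y z (+ 0 , + t) → z ≤ t

-- bilinear form ((x,y),(x',y')) = (xy'+x'y)/M on (ℤ/Mℤ)²; "= 0 in ℚ/ℤ"
B2-zero : ℕ → Elt2 → Elt2 → Set
B2-zero M (x , y) (x' , y') = (+ M) ∣ (x * y' + x' * y)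

Perp2 : ℕ → (Elt2 → Set) → Elt2 → Set
Perp2 M S γ = ∀ δ → S δ → B2-zero M γ δ

-- D = (ℤ/Nℤ)² ⊕ (ℤ/N'ℤ)², represented by ℤ⁴

Elt : Set
Elt = ℤ × ℤ × ℤ × ℤ

_≈D[_,_]_ : Elt → ℕ → ℕ → Elt → Set
(x , y , z , w) ≈D[ N , N' ] (x' , y' , z' , w') =
  (x ≡ x' [mod N ]) × (y ≡ y' [mod N ]) × (z ≡ z' [mod N' ]) × (w ≡ w' [mod N' ])

zeroD : Elt
zeroD = (+ 0 , + 0 , + 0 , + 0)

_+D_ : Elt → Elt → Elt
(x , y , z , w) +D (x' , y' , z' , w') = (x + x' , y + y' , z + z' , w + w')

-D_ : Elt → Elt
-D (x , y , z , w) = (- x , - y , - z , - w)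

_·D_ : ℤ → Elt → Elt
k ·D (x , y , z , w) = (k * x , k * y , k * z , k * w)

record IsSubgroupD (N N' : ℕ) (H : Elt → Set) : Set where
  field
    has-zero : H zeroD
    closed-+ : ∀ v w → H v → H w → H (v +D w)
    closed-- : ∀ v → H v → H (-D v)
    has-kernel : ∀ v → v ≈D[ N , N' ] zeroD → H v

-- Q(x,y,z,w) = xy/N + zw/N' ≡ 0 mod ℤ   ⇔   N N' ∣ N' x y + N z w
Q-zero : ℕ → ℕ → Elt → Set
Q-zero N N' (x , y , z , w) = + (N ℕ.* N') ∣ (+ N' * (x * y) + + N * (z * w))

-- bilinear form (γ,γ') = (xy'+x'y)/N + (zw'+z'w)/N' ≡ 0 mod ℤ
B-zero : ℕ → ℕ → Elt → Elt → Set
B-zero N N' (x , y , z , w) (x' , y' , z' , w') =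
  + (N ℕ.* N') ∣ (+ N' * (x * y' + x' * y) + + N * (z * w' + z' * w))

PerpD : ℕ → ℕ → (Elt → Set) → Elt → Set
PerpD N N' H γ = ∀ δ → H δ → B-zero N N' γ δ

SelfDual : ℕ → ℕ → (Elt → Set) → Set
SelfDual N N' H = ∀ v → H v ⟺ PerpD N N' H v

Isotropic : ℕ → ℕ → (Elt → Set) → Set
Isotropic N N' H = (∀ v → H v → PerpD N N' H v) × (∀ v → H v → Q-zero N N' v)

π₁ : (Elt → Set) → Elt2 → Set
π₁ H (u , v) = ∃[ s ] ∃[ t ] H (u , v , s , t)

π₂ : (Elt → Set) → Elt2 → Set
π₂ H (s , t) = ∃[ u ] ∃[ v ] H (u , v , s , t)

Span4 : ℕ → ℕ → Elt → Elt → Elt → Elt → Elt → Set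
Span4 N N' g₁ g₂ g₃ g₄ v =
  ∃[ k₁ ] ∃[ k₂ ] ∃[ k₃ ] ∃[ k₄ ]
    (v ≈D[ N , N' ] ((k₁ ·D g₁) +D ((k₂ ·D g₂) +D ((k₃ ·D g₃) +D (k₄ ·D g₄)))))

GenH : ℕ → ℕ → (x y z x' y' z' : ℕ) → ℤ → ℤ → ℤ → ℤ → Elt → Set
GenH N N' x y z x' y' z' a b c d =
  Span4 N N'
    (+ x , + y , a , b)
    (+ 0 , + z , c , d)
    (+ 0 , + 0 , + divℕ N' z' , - (+ divℕ (N' ℕ.* y') (x' ℕ.* z')))
    (+ 0 , + 0 , + 0 , + divℕ N' x')

-- Lift the generators of π₁(H) to g₁ = (x,y,a,b) and g₂ = (0,z,c,d) in H.  For self-dual H the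
-- N-part of the pairing vanishes on (0,0,e,f), so (0,0,e,f) ∈ H exactly when (e,f) is orthogonal
-- to π₂(H) = H_{x',y',z'}.  That complement is spanned by (N'/z', -q) and (0, N'/x') with
-- q = N'y'/(x'z'); q is an integer and (N'/z') y' = x' q because z' ∣ (N'/x') y', which is
-- where the minimality of z' enters.  Subtracting from h ∈ H the combination of g₁, g₂ with the
-- same π₁-image leaves such a kernel element, so the four generators span H; and two admissible
-- choices of (a,b) give lifts of (x,y) whose difference is a kernel element, i.e. lies in
-- H_{x',y',z'}^⊥.
module Submission where

open import Defs
open import Data.Nat using (ℕ; _≤_)
open import Data.Nat.Divisibility using (_∣_)
open import Data.Integer using (ℤ; _-_)
open import Data.Product using (_×_; _,_; ∃-syntax; proj₁; proj₂)

open import Data.Nat as ℕ using (suc; NonZero; >-nonZero; s≤s; z≤n)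
import Data.Nat.Properties as ℕₚ
open import Algebra.Properties.CommutativeSemigroup ℕₚ.*-commutativeSemigroup
  using (x∙yz≈y∙xz; x∙yz≈yx∙z; xy∙z≈y∙xz; xy∙z≈xz∙y)
import Data.Nat.Divisibility as ℕ∣
open import Data.Nat.DivMod using (_/_; _%_; m%n<n; m≡m%n+[m/n]*n; m*n/n≡m; m/n*n≡m)
open import Data.Integer using (+_; -_; _+_; _*_; +0; -[1+_])
import Data.Integer.Properties as ℤₚ
import Data.Integer.Divisibility as ℤᵘ
open import Data.Integer.Divisibility.Signed as ℤˢ
  using (divides; ∣ᵤ⇒∣; ∣⇒∣ᵤ; ∣-refl; ∣m⇒∣-m; ∣m∣n⇒∣m+n; ∣n⇒∣m*n)
  renaming (_∣_ to _∣ˢ_)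
open import Data.Integer.Tactic.RingSolver using (solve-∀)
open import Data.Empty using (⊥-elim)
open import Function using (_∘_)
open import Relation.Binary.PropositionalEquality

∣-via : ∀ {k e e′} → e ≡ e′ → k ∣ˢ e′ → k ∣ˢ e
∣-via {k} e≡e′ = subst (k ∣ˢ_) (sym e≡e′)

∣0 : ∀ {k} → k ∣ˢ +0
∣0 = divides +0 refl

-- `a ≡ b [mod M ]` reduces to a divisibility between absolute values, on which unification gets
-- stuck; hence a and b are explicit here, and proofs work with signed divisibility in between.
∣⇒≡-mod : ∀ {M} a b → + M ∣ˢ a - b → a ≡ b [mod M ]
∣⇒≡-mod a b = ∣⇒∣ᵤ

≡-mod⇒∣ : ∀ {M} a b → a ≡ b [mod M ] → + M ∣ˢ a - b
≡-mod⇒∣ a b = ∣ᵤ⇒∣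

≡-mod-refl : ∀ {M} a → a ≡ a [mod M ]
≡-mod-refl a = ∣⇒≡-mod a a (∣-via (ℤₚ.+-inverseʳ a) ∣0)

≡⇒≡-mod : ∀ {M a b} → a ≡ b → a ≡ b [mod M ]
≡⇒≡-mod {a = a} refl = ≡-mod-refl a

≡-Elt : ∀ {a b c d a′ b′ c′ d′ : ℤ} → a ≡ a′ → b ≡ b′ → c ≡ c′ → d ≡ d′ →
        _≡_ {A = Elt} (a , b , c , d) (a′ , b′ , c′ , d′)
≡-Elt refl refl refl refl = refl

module _ {N N' : ℕ} {H : Elt → Set} (sg : IsSubgroupD N N' H) where
  open IsSubgroupD sg

  ∈-resp-≈D : ∀ {v w} → v ≈D[ N , N' ] w → H w → H v
  ∈-resp-≈D {v₁ , v₂ , v₃ , v₄} {w₁ , w₂ , w₃ , w₄} (e₁ , e₂ , e₃ , e₄) w∈H =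
    subst H (≡-Elt (w+[v-w]≡v v₁ w₁) (w+[v-w]≡v v₂ w₂) (w+[v-w]≡v v₃ w₃) (w+[v-w]≡v v₄ w₄))
      (closed-+ _ _ w∈H (has-kernel _
        (kernel-part v₁ w₁ e₁ , kernel-part v₂ w₂ e₂ , kernel-part v₃ w₃ e₃ , kernel-part v₄ w₄ e₄)))
    where
    w+[v-w]≡v : ∀ v w → w + (v - w) ≡ v
    w+[v-w]≡v = solve-∀
    kernel-part : ∀ {M} a b → a ≡ b [mod M ] → (a - b) ≡ +0 [mod M ]
    kernel-part a b a≡b =
      ∣⇒≡-mod (a - b) +0 (∣-via (ℤₚ.+-identityʳ (a - b)) (≡-mod⇒∣ a b a≡b))

  ℕ·D-closed : ∀ n {v} → H v → H ((+ n) ·D v)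
  ℕ·D-closed 0 v∈H = has-zero
  ℕ·D-closed (suc n) {a , b , c , d} v∈H =
    subst H (≡-Elt (sym (1+n*x a)) (sym (1+n*x b)) (sym (1+n*x c)) (sym (1+n*x d)))
      (closed-+ _ _ v∈H (ℕ·D-closed n v∈H))
    where
    1+n*x : ∀ x → + suc n * x ≡ x + + n * x
    1+n*x x = trans (ℤₚ.*-distribʳ-+ x (+ 1) (+ n)) (cong (_+ + n * x) (ℤₚ.*-identityˡ x))

  ·D-closed : ∀ k {v} → H v → H (k ·D v)
  ·D-closed (+ n) v∈H = ℕ·D-closed n v∈H
  ·D-closed -[1+ n ] {a , b , c , d} v∈H =
    subst H (≡-Elt (neg a) (neg b) (neg c) (neg d)) (closed-- _ (ℕ·D-closed (suc n) v∈H))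
    where
    neg : ∀ x → - (+ suc n * x) ≡ -[1+ n ] * x
    neg = ℤₚ.neg-distribˡ-* (+ suc n)

  Span4⊆ : ∀ {g₁ g₂ g₃ g₄} → H g₁ → H g₂ → H g₃ → H g₄ →
           ∀ v → Span4 N N' g₁ g₂ g₃ g₄ v → H v
  Span4⊆ g₁∈H g₂∈H g₃∈H g₄∈H v (k₁ , k₂ , k₃ , k₄ , v≈) =
    ∈-resp-≈D v≈ (closed-+ _ _ (·D-closed k₁ g₁∈H) (closed-+ _ _ (·D-closed k₂ g₂∈H)
      (closed-+ _ _ (·D-closed k₃ g₃∈H) (·D-closed k₄ g₄∈H))))

∈Span4₁ : ∀ {N N'} g₁ g₂ g₃ g₄ → Span4 N N' g₁ g₂ g₃ g₄ g₁
∈Span4₁ (a₁ , b₁ , c₁ , d₁) (a₂ , b₂ , c₂ , d₂) (a₃ , b₃ , c₃ , d₃) (a₄ , b₄ , c₄ , d₄) =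
  + 1 , +0 , +0 , +0 , ≡⇒≡-mod (pick a₁ a₂ a₃ a₄) , ≡⇒≡-mod (pick b₁ b₂ b₃ b₄)
                     , ≡⇒≡-mod (pick c₁ c₂ c₃ c₄) , ≡⇒≡-mod (pick d₁ d₂ d₃ d₄)
  where
  pick : ∀ u₁ u₂ u₃ u₄ → u₁ ≡ + 1 * u₁ + (+0 * u₂ + (+0 * u₃ + +0 * u₄))
  pick = solve-∀

∈Span4₂ : ∀ {N N'} g₁ g₂ g₃ g₄ → Span4 N N' g₁ g₂ g₃ g₄ g₂
∈Span4₂ (a₁ , b₁ , c₁ , d₁) (a₂ , b₂ , c₂ , d₂) (a₃ , b₃ , c₃ , d₃) (a₄ , b₄ , c₄ , d₄) =
  +0 , + 1 , +0 , +0 , ≡⇒≡-mod (pick a₁ a₂ a₃ a₄) , ≡⇒≡-mod (pick b₁ b₂ b₃ b₄)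
                     , ≡⇒≡-mod (pick c₁ c₂ c₃ c₄) , ≡⇒≡-mod (pick d₁ d₂ d₃ d₄)
  where
  pick : ∀ u₁ u₂ u₃ u₄ → u₂ ≡ +0 * u₁ + (+ 1 * u₂ + (+0 * u₃ + +0 * u₄))
  pick = solve-∀

Hxyz-gen₁ : ∀ {M x y z} → Hxyz M x y z (+ x , + y)
Hxyz-gen₁ {M} {x} {y} {z} =
  + 1 , +0 , ≡⇒≡-mod (sym (ℤₚ.*-identityˡ (+ x))) , ≡⇒≡-mod (pick (+ y) (+ z))
  where
  pick : ∀ y z → y ≡ + 1 * y + +0 * z
  pick = solve-∀

Hxyz-gen₂ : ∀ {M x y z} → Hxyz M x y z (+0 , + z)
Hxyz-gen₂ {M} {x} {y} {z} = +0 , + 1 , ≡-mod-refl +0 , ≡⇒≡-mod (pick (+ y) (+ z))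
  where
  pick : ∀ y z → z ≡ +0 * y + + 1 * z
  pick = solve-∀

⊥-Hxyz : ∀ {M x y z} e f → B2-zero M (e , f) (+ x , + y) → B2-zero M (e , f) (+0 , + z) →
         Perp2 M (Hxyz M x y z) (e , f)
⊥-Hxyz {M} {x} {y} {z} e f ⊥gen₁ ⊥gen₂ (s , t) (k , l , s≡kx , t≡ky+lz) =
  ∣⇒∣ᵤ (∣-via (expand e f s t k l (+ x) (+ y) (+ z))
    (∣m∣n⇒∣m+n (∣m∣n⇒∣m+n (∣m∣n⇒∣m+n
      (∣n⇒∣m*n e (≡-mod⇒∣ t _ t≡ky+lz)) (∣n⇒∣m*n f (≡-mod⇒∣ s _ s≡kx)))
      (∣n⇒∣m*n k (∣ᵤ⇒∣ ⊥gen₁))) (∣n⇒∣m*n l (∣ᵤ⇒∣ ⊥gen₂))))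
  where
  expand : ∀ e f s t k l x y z →
           e * t + s * f ≡ e * (t - (k * y + l * z)) + f * (s - k * x)
                           + k * (e * y + x * f) + l * (e * z + +0 * f)
  expand = solve-∀

module PerpBasis {M x y z A B q : ℕ} .{{_ : NonZero x}} .{{_ : NonZero z}}
  (A*x≡M : A ℕ.* x ≡ M) (B*z≡M : B ℕ.* z ≡ M) (B*y≡x*q : B ℕ.* y ≡ x ℕ.* q) where

  private
    ℤ-* : ∀ m n {k} → m ℕ.* n ≡ k → + m * + n ≡ + k
    ℤ-* m n eq = trans (sym (ℤₚ.pos-* m n)) (cong +_ eq)

    ℤA*x≡M : + A * + x ≡ + M
    ℤA*x≡M = ℤ-* A x A*x≡M
    ℤB*z≡M : + B * + z ≡ + M
    ℤB*z≡M = ℤ-* B z B*z≡M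
    ℤB*y≡x*q : + B * + y ≡ + x * + q
    ℤB*y≡x*q = trans (ℤ-* B y B*y≡x*q) (ℤₚ.pos-* x q)

  ⊥-basis₁ : Perp2 M (Hxyz M x y z) (+ B , - + q)
  ⊥-basis₁ =
    ⊥-Hxyz (+ B) (- + q) (∣⇒∣ᵤ (∣-via ⊥gen₁ (∣0 {+ M}))) (∣⇒∣ᵤ (∣-via ⊥gen₂ (∣-refl {+ M})))
    where
    ⊥gen₁ : + B * + y + + x * - + q ≡ +0
    ⊥gen₁ = begin
      + B * + y + + x * - + q     ≡⟨ cong (_+ + x * - + q) ℤB*y≡x*q ⟩
      + x * + q + + x * - + q     ≡⟨ ℤₚ.*-distribˡ-+ (+ x) (+ q) (- + q) ⟨
      + x * (+ q - + q)           ≡⟨ cong (+ x *_) (ℤₚ.+-inverseʳ (+ q)) ⟩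
      + x * +0                    ≡⟨ ℤₚ.*-zeroʳ (+ x) ⟩
      +0                          ∎
      where open ≡-Reasoning
    ⊥gen₂ : + B * + z + +0 * - + q ≡ + M
    ⊥gen₂ = trans (ℤₚ.+-identityʳ (+ B * + z)) ℤB*z≡M

  ⊥-basis₂ : Perp2 M (Hxyz M x y z) (+0 , + A)
  ⊥-basis₂ = ⊥-Hxyz +0 (+ A) (∣⇒∣ᵤ (∣-via ⊥gen₁ (∣-refl {+ M}))) (∣⇒∣ᵤ (∣0 {+ M}))
    where
    ⊥gen₁ : +0 * + y + + x * + A ≡ + M
    ⊥gen₁ = trans (ℤₚ.+-identityˡ (+ x * + A)) (trans (ℤₚ.*-comm (+ x) (+ A)) ℤA*x≡M)

  ⊥⇒basis-combination : ∀ {s t} → Perp2 M (Hxyz M x y z) (s , t) →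
                        ∃[ e ] ∃[ f ] (s ≡ e * + B × e * + q + t ≡ f * + A)
  ⊥⇒basis-combination {s} {t} s,t⊥ = e , f , s≡e*B , e*q+t≡f*A
    where
    ⊥gen₁ : + M ∣ˢ s * + y + + x * t
    ⊥gen₁ = ∣ᵤ⇒∣ (s,t⊥ (+ x , + y) Hxyz-gen₁)
    ⊥gen₂ : + M ∣ˢ s * + z + +0 * t
    ⊥gen₂ = ∣ᵤ⇒∣ (s,t⊥ (+0 , + z) Hxyz-gen₂)
    open ℤˢ._∣_ ⊥gen₂ renaming (quotient to e; equality to s*z≡e*M)
    s≡e*B : s ≡ e * + B
    s≡e*B = ℤₚ.*-cancelʳ-≡ s (e * + B) (+ z) (begin
      s * + z             ≡⟨ ℤₚ.+-identityʳ (s * + z) ⟨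
      s * + z + +0 * t    ≡⟨ s*z≡e*M ⟩
      e * + M             ≡⟨ cong (e *_) ℤB*z≡M ⟨
      e * (+ B * + z)     ≡⟨ ℤₚ.*-assoc e (+ B) (+ z) ⟨
      e * + B * + z       ∎)
      where open ≡-Reasoning
    x∣[e*q+t] : + M ∣ˢ + x * (e * + q + t)
    x∣[e*q+t] = ∣-via regroup ⊥gen₁
      where
      open ≡-Reasoning
      distrib : ∀ e q t x → x * (e * q + t) ≡ e * (x * q) + x * t
      distrib = solve-∀
      regroup : + x * (e * + q + t) ≡ s * + y + + x * t
      regroup = begin
        + x * (e * + q + t)           ≡⟨ distrib e (+ q) t (+ x) ⟩
        e * (+ x * + q) + + x * t     ≡⟨ cong (λ u → e * u + + x * t) ℤB*y≡x*q ⟨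
        e * (+ B * + y) + + x * t     ≡⟨ cong (_+ + x * t) (ℤₚ.*-assoc e (+ B) (+ y)) ⟨
        e * + B * + y + + x * t       ≡⟨ cong (λ u → u * + y + + x * t) s≡e*B ⟨
        s * + y + + x * t             ∎
    open ℤˢ._∣_ x∣[e*q+t] renaming (quotient to f; equality to x*[e*q+t]≡f*M)
    e*q+t≡f*A : e * + q + t ≡ f * + A
    e*q+t≡f*A = ℤₚ.*-cancelˡ-≡ (+ x) (e * + q + t) (f * + A) (begin
      + x * (e * + q + t)   ≡⟨ x*[e*q+t]≡f*M ⟩
      f * + M               ≡⟨ cong (f *_) ℤA*x≡M ⟨
      f * (+ A * + x)       ≡⟨ rotate f (+ A) (+ x) ⟩
      + x * (f * + A)       ∎)
      where
      open ≡-Reasoning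
      rotate : ∀ f a x → f * (a * x) ≡ x * (f * a)
      rotate = solve-∀

divℕ-*ʳ : ∀ {m n} → n ℕ∣.∣ m → divℕ m n ℕ.* n ≡ m
divℕ-*ʳ {n = 0} 0∣m = sym (ℕ∣.0∣⇒≡0 0∣m)
divℕ-*ʳ {n = suc _} n∣m = m/n*n≡m n∣m

divℕ-*-cancelʳ : ∀ m n .{{_ : NonZero n}} → divℕ (m ℕ.* n) n ≡ m
divℕ-*-cancelʳ m (suc n) = m*n/n≡m m (suc n)

module _ {M x y z : ℕ} (nz : Normalized M x y z) where
  open Normalized nz

  instance
    x≢0 : NonZero x
    x≢0 = >-nonZero x-pos
    z≢0 : NonZero z
    z≢0 = >-nonZero z-pos

  -- (0, (M/x) y) = (M/x)·(x,y) lies in H_{x,y,z}, hence so does (0, (M/x) y mod z), and the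
  -- minimality of z forces that remainder to vanish.
  z∣[M/x]*y : z ℕ∣.∣ divℕ M x ℕ.* y
  z∣[M/x]*y = ℕ∣.m%n≡0⇒n∣m W z (remainder≡0 (W % z) (m%n<n W z) remainder∈H)
    where
    A = divℕ M x
    W = A ℕ.* y
    remainder≡0 : ∀ r → r ℕ.< z → Hxyz M x y z (+0 , + r) → r ≡ 0
    remainder≡0 0 _ _ = refl
    remainder≡0 (suc r) r<z r∈H = ⊥-elim (ℕₚ.<⇒≱ r<z (z-least (suc r) (s≤s z≤n) r∈H))
    remainder∈H : Hxyz M x y z (+0 , + (W % z))
    remainder∈H = + A , - + (W / z) , 0≡A*x , W%z≡A*y-[W/z]*z
      where
      open ≡-Reasoning
      0≡A*x : +0 ≡ (+ A * + x) [mod M ]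
      0≡A*x = ∣⇒≡-mod +0 (+ A * + x) (∣-via (begin
          +0 - + A * + x    ≡⟨ ℤₚ.+-identityˡ (- (+ A * + x)) ⟩
          - (+ A * + x)     ≡⟨ cong -_ (ℤₚ.pos-* A x) ⟨
          - + (A ℕ.* x)     ≡⟨ cong (-_ ∘ +_) (divℕ-*ʳ x∣M) ⟩
          - + M             ∎)
        (∣m⇒∣-m ∣-refl))
      W≡W%z+[W/z]*z : + A * + y ≡ + (W % z) + + (W / z) * + z
      W≡W%z+[W/z]*z = begin
        + A * + y                       ≡⟨ ℤₚ.pos-* A y ⟨
        + W                             ≡⟨ cong +_ (m≡m%n+[m/n]*n W z) ⟩
        + (W % z ℕ.+ W / z ℕ.* z)       ≡⟨ ℤₚ.pos-+ (W % z) (W / z ℕ.* z) ⟩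
        + (W % z) + + (W / z ℕ.* z)     ≡⟨ cong (_+_ (+ (W % z))) (ℤₚ.pos-* (W / z) z) ⟩
        + (W % z) + + (W / z) * + z     ∎
      add-sub-cancel : ∀ r u z → r ≡ r + u * z + - u * z
      add-sub-cancel = solve-∀
      W%z≡A*y-[W/z]*z : (+ (W % z)) ≡ (+ A * + y + - + (W / z) * + z) [mod M ]
      W%z≡A*y-[W/z]*z = ≡⇒≡-mod (begin
        + (W % z)                    ≡⟨ add-sub-cancel (+ (W % z)) (+ (W / z)) (+ z) ⟩
        + (W % z) + + (W / z) * + z + - + (W / z) * + z
                                     ≡⟨ cong (λ u → u + - + (W / z) * + z) W≡W%z+[W/z]*z ⟨
        + A * + y + - + (W / z) * + z  ∎)

  M/x*x≡M : divℕ M x ℕ.* x ≡ M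
  M/x*x≡M = divℕ-*ʳ x∣M

  M/z*z≡M : divℕ M z ℕ.* z ≡ M
  M/z*z≡M = divℕ-*ʳ z∣M

  M/z*y≡x*q : divℕ M z ℕ.* y ≡ x ℕ.* divℕ (M ℕ.* y) (x ℕ.* z)
  M/z*y≡x*q with z∣[M/x]*y
  ... | ℕ∣.divides Q A*y≡Q*z = trans B*y≡x*Q (cong (x ℕ.*_) (sym q≡Q))
    where
    open ≡-Reasoning
    A = divℕ M x
    B = divℕ M z
    M*y≡Q*[x*z] : M ℕ.* y ≡ Q ℕ.* (x ℕ.* z)
    M*y≡Q*[x*z] = begin
      M ℕ.* y               ≡⟨ cong (ℕ._* y) M/x*x≡M ⟨
      A ℕ.* x ℕ.* y         ≡⟨ xy∙z≈y∙xz A x y ⟩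
      x ℕ.* (A ℕ.* y)       ≡⟨ cong (x ℕ.*_) A*y≡Q*z ⟩
      x ℕ.* (Q ℕ.* z)       ≡⟨ x∙yz≈y∙xz x Q z ⟩
      Q ℕ.* (x ℕ.* z)       ∎
    q≡Q : divℕ (M ℕ.* y) (x ℕ.* z) ≡ Q
    q≡Q = trans (cong (λ m → divℕ m (x ℕ.* z)) M*y≡Q*[x*z])
                (divℕ-*-cancelʳ Q (x ℕ.* z) {{ℕₚ.m*n≢0 x z}})
    B*y≡x*Q : B ℕ.* y ≡ x ℕ.* Q
    B*y≡x*Q = ℕₚ.*-cancelʳ-≡ (B ℕ.* y) (x ℕ.* Q) z (begin
      B ℕ.* y ℕ.* z         ≡⟨ xy∙z≈xz∙y B y z ⟩
      B ℕ.* z ℕ.* y         ≡⟨ cong (ℕ._* y) M/z*z≡M ⟩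
      M ℕ.* y               ≡⟨ M*y≡Q*[x*z] ⟩
      Q ℕ.* (x ℕ.* z)       ≡⟨ x∙yz≈yx∙z Q x z ⟩
      x ℕ.* Q ℕ.* z         ∎)

module _ {N N' : ℕ} .{{_ : NonZero N}} where

  B-zero⇔B2-zero : ∀ e f u v s t →
    B-zero N N' (+0 , +0 , e , f) (u , v , s , t) ⟺ B2-zero N' (e , f) (s , t)
  B-zero⇔B2-zero e f u v s t =
      (λ p → ℤᵘ.*-cancelˡ-∣ (+ N) (subst₂ ℤᵘ._∣_ (ℤₚ.pos-* N N') drop-first p))
    , (λ p → subst₂ ℤᵘ._∣_ (sym (ℤₚ.pos-* N N')) (sym drop-first) (ℤᵘ.*-monoʳ-∣ (+ N) p))
    where
    zero-summand : ∀ n n′ u v w → n * (+0 * v + u * +0) + n′ * w ≡ n′ * w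
    zero-summand = solve-∀
    drop-first : + N' * (+0 * v + u * +0) + + N * (e * t + s * f) ≡ + N * (e * t + s * f)
    drop-first = zero-summand (+ N') (+ N) u v (e * t + s * f)

  kernel⇔⊥π₂ : ∀ {H} → SelfDual N N' H → ∀ e f →
               H (+0 , +0 , e , f) ⟺ Perp2 N' (π₂ H) (e , f)
  kernel⇔⊥π₂ sd e f =
      (λ e,f∈H → λ { (s , t) (u , v , δ∈H) →
          proj₁ (B-zero⇔B2-zero e f u v s t) (proj₁ (sd _) e,f∈H _ δ∈H) })
    , (λ e,f⊥ → proj₂ (sd _) λ { (u , v , s , t) δ∈H →
          proj₂ (B-zero⇔B2-zero e f u v s t) (e,f⊥ (s , t) (u , v , δ∈H)) })

module Decomposition {N N' : ℕ} .{{_ : NonZero N}} {H : Elt → Set}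
  (sg : IsSubgroupD N N' H) (sd : SelfDual N N' H)
  {x y z x' y' z' : ℕ} (nz' : Normalized N' x' y' z')
  (π₁H : ∀ γ → π₁ H γ ⟺ Hxyz N x y z γ) (π₂H : ∀ γ → π₂ H γ ⟺ Hxyz N' x' y' z' γ) where

  open IsSubgroupD sg

  private
    A = divℕ N' x'
    B = divℕ N' z'
    q = divℕ (N' ℕ.* y') (x' ℕ.* z')

  open PerpBasis {A = A} {B} {q} {{x≢0 nz'}} {{z≢0 nz'}}
                 (M/x*x≡M nz') (M/z*z≡M nz') (M/z*y≡x*q nz')

  kernel⇔⊥ : ∀ e f → H (+0 , +0 , e , f) ⟺ Perp2 N' (Hxyz N' x' y' z') (e , f)
  kernel⇔⊥ e f =
      (λ e,f∈H δ δ∈ → proj₁ (kernel⇔⊥π₂ sd e f) e,f∈H δ (proj₂ (π₂H δ) δ∈))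
    , (λ e,f⊥ → proj₂ (kernel⇔⊥π₂ sd e f) λ δ δ∈ → e,f⊥ δ (proj₁ (π₂H δ) δ∈))

  lift-difference-⊥ : ∀ {u v a b a₂ b₂} → H (u , v , a , b) → H (u , v , a₂ , b₂) →
                      Perp2 N' (Hxyz N' x' y' z') (a₂ - a , b₂ - b)
  lift-difference-⊥ {u} {v} {a} {b} {a₂} {b₂} h h₂ =
    proj₁ (kernel⇔⊥ (a₂ - a) (b₂ - b)) (∈-resp-≈D sg
      ( ≡⇒≡-mod (sym (ℤₚ.+-inverseʳ u)) , ≡⇒≡-mod (sym (ℤₚ.+-inverseʳ v))
      , ≡-mod-refl (a₂ - a) , ≡-mod-refl (b₂ - b))
      (closed-+ _ _ h₂ (closed-- _ h)))

  GenH⊆H : ∀ {a b c d} → H (+ x , + y , a , b) → H (+0 , + z , c , d) →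
           ∀ v → GenH N N' x y z x' y' z' a b c d v → H v
  GenH⊆H g₁∈H g₂∈H =
    Span4⊆ sg g₁∈H g₂∈H (proj₂ (kernel⇔⊥ (+ B) (- + q)) ⊥-basis₁)
                        (proj₂ (kernel⇔⊥ +0 (+ A)) ⊥-basis₂)

  residual∈H : ∀ {a b c d p r s t} k l → H (+ x , + y , a , b) → H (+0 , + z , c , d) →
    H (p , r , s , t) → p ≡ k * + x [mod N ] → r ≡ (k * + y + l * + z) [mod N ] →
    H (+0 , +0 , s - (k * a + l * c) , t - (k * b + l * d))
  residual∈H {a} {b} {c} {d} {p} {r} {s} {t} k l g₁∈H g₂∈H v∈H p≡kx r≡ky+lz =
    ∈-resp-≈D sg
      ( ∣⇒≡-mod +0 (p + (- k * + x + - l * +0))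
          (∣-via (first p k (+ x) l) (∣m⇒∣-m (≡-mod⇒∣ p _ p≡kx)))
      , ∣⇒≡-mod +0 (r + (- k * + y + - l * + z))
          (∣-via (second r k (+ y) l (+ z)) (∣m⇒∣-m (≡-mod⇒∣ r _ r≡ky+lz)))
      , ≡⇒≡-mod (rest s k a l c) , ≡⇒≡-mod (rest t k b l d))
      (closed-+ _ _ v∈H (closed-+ _ _ (·D-closed sg (- k) g₁∈H) (·D-closed sg (- l) g₂∈H)))
    where
    first : ∀ p k x l → +0 - (p + (- k * x + - l * +0)) ≡ - (p - k * x)
    first = solve-∀
    second : ∀ r k y l z → +0 - (r + (- k * y + - l * z)) ≡ - (r - (k * y + l * z))
    second = solve-∀
    rest : ∀ s k a l c → s - (k * a + l * c) ≡ s + (- k * a + - l * c)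
    rest = solve-∀

  GenH-intro : ∀ {a b c d p r s t} k l e f →
    p ≡ k * + x [mod N ] → r ≡ (k * + y + l * + z) [mod N ] →
    s - (k * a + l * c) ≡ e * + B → e * + q + (t - (k * b + l * d)) ≡ f * + A →
    GenH N N' x y z x' y' z' a b c d (p , r , s , t)
  GenH-intro {a} {b} {c} {d} {p} {r} {s} {t} k l e f p≡kx r≡ky+lz s′≡e*B e*q+t′≡f*A =
    k , l , e , f
    , ∣⇒≡-mod p _ (∣-via (first p k (+ x) l e f) (≡-mod⇒∣ p _ p≡kx))
    , ∣⇒≡-mod r _ (∣-via (second r k (+ y) l (+ z) e f) (≡-mod⇒∣ r _ r≡ky+lz))
    , ≡⇒≡-mod (trans (third s k a l c f)
                     (cong (λ u → k * a + (l * c + (u + f * +0))) s′≡e*B))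
    , ≡⇒≡-mod (trans (fourth t k b l d e (+ q))
                     (cong (λ u → k * b + (l * d + (e * - + q + u))) e*q+t′≡f*A))
    where
    first : ∀ p k x l e f → p - (k * x + (l * +0 + (e * +0 + f * +0))) ≡ p - k * x
    first = solve-∀
    second : ∀ r k y l z e f →
             r - (k * y + (l * z + (e * +0 + f * +0))) ≡ r - (k * y + l * z)
    second = solve-∀
    third : ∀ s k a l c f → s ≡ k * a + (l * c + ((s - (k * a + l * c)) + f * +0))
    third = solve-∀
    fourth : ∀ t k b l d e q →
             t ≡ k * b + (l * d + (e * - q + (e * q + (t - (k * b + l * d)))))
    fourth = solve-∀

  H⊆GenH : ∀ {a b c d} → H (+ x , + y , a , b) → H (+0 , + z , c , d) →
           ∀ v → H v → GenH N N' x y z x' y' z' a b c d v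
  H⊆GenH {a} {b} {c} {d} g₁∈H g₂∈H (p , r , s , t) v∈H =
    let k , l , p≡kx , r≡ky+lz = proj₁ (π₁H (p , r)) (s , t , v∈H)
        residual = residual∈H k l g₁∈H g₂∈H v∈H p≡kx r≡ky+lz
        e , f , s′≡e*B , e*q+t′≡f*A = ⊥⇒basis-combination
          (proj₁ (kernel⇔⊥ (s - (k * a + l * c)) (t - (k * b + l * d))) residual)
    in GenH-intro {a} {b} {c} {d} {p} {r} {s} {t} k l e f p≡kx r≡ky+lz s′≡e*B e*q+t′≡f*A

  coefficients-unique : ∀ {a b c d a₂ b₂ c₂ d₂} →
    H (+ x , + y , a , b) → H (+0 , + z , c , d) →
    (∀ v → H v ⟺ GenH N N' x y z x' y' z' a₂ b₂ c₂ d₂ v) →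
    Perp2 N' (Hxyz N' x' y' z') (a₂ - a , b₂ - b) × Perp2 N' (Hxyz N' x' y' z') (c₂ - c , d₂ - d)
  coefficients-unique {a₂ = a₂} {b₂} {c₂} {d₂} g₁∈H g₂∈H H⇔GenH₂ =
      lift-difference-⊥ g₁∈H (proj₂ (H⇔GenH₂ g₁) (∈Span4₁ g₁ g₂ g₃ g₄))
    , lift-difference-⊥ g₂∈H (proj₂ (H⇔GenH₂ g₂) (∈Span4₂ g₁ g₂ g₃ g₄))
    where
    g₁ g₂ g₃ g₄ : Elt
    g₁ = + x , + y , a₂ , b₂
    g₂ = +0 , + z , c₂ , d₂
    g₃ = +0 , +0 , + B , - + q
    g₄ = +0 , +0 , +0 , + A

lemma4p4 : (N N' : ℕ) → 1 ≤ N → 1 ≤ N' → N' ∣ N →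
    (H : Elt → Set) → IsSubgroupD N N' H → SelfDual N N' H → Isotropic N N' H →
    (x y z x' y' z' : ℕ) →
    Normalized N x y z → Normalized N' x' y' z' →
    (∀ γ → π₁ H γ ⟺ Hxyz N x y z γ) →
    (∀ γ → π₂ H γ ⟺ Hxyz N' x' y' z' γ) →
    ∃[ a ] ∃[ b ] ∃[ c ] ∃[ d ]
      (Hxyz N' x' y' z' (a , b) × Hxyz N' x' y' z' (c , d)
       × (∀ v → H v ⟺ GenH N N' x y z x' y' z' a b c d v)
       × (∀ a₂ b₂ c₂ d₂ →
            Hxyz N' x' y' z' (a₂ , b₂) → Hxyz N' x' y' z' (c₂ , d₂) →
            (∀ v → H v ⟺ GenH N N' x y z x' y' z' a₂ b₂ c₂ d₂ v) →
            Perp2 N' (Hxyz N' x' y' z') (a₂ - a , b₂ - b)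
            × Perp2 N' (Hxyz N' x' y' z') (c₂ - c , d₂ - d)))
lemma4p4 N N' N≥1 _ _ H sg sd _ x y z x' y' z' _ nz' π₁H π₂H
  with proj₂ (π₁H (+ x , + y)) Hxyz-gen₁ | proj₂ (π₁H (+0 , + z)) Hxyz-gen₂
... | a , b , g₁∈H | c , d , g₂∈H =
  a , b , c , d
  , proj₁ (π₂H (a , b)) (_ , _ , g₁∈H) , proj₁ (π₂H (c , d)) (_ , _ , g₂∈H)
  , (λ v → H⊆GenH g₁∈H g₂∈H v , GenH⊆H g₁∈H g₂∈H v)
  , λ _ _ _ _ _ _ → coefficients-unique g₁∈H g₂∈H
  where open Decomposition {{>-nonZero N≥1}} sg sd nz' π₁H π₂H
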